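{- Let $P$ be a finite nonempty connected $\Gamma$-colored poset satisfying EC, NA, AC, and ICE2, and let $m\ge1$ and $q>p\ge0$ be integers. Then for distinct colors $b,c\in\Gamma$, $$\sum_{k=0}^{q}(-1)^k\langle c^{q-k},b^p,c^k\rangle=0$$ as operators on $m$-tuples of ideals and on $m$-multisets of ideals.
   Context: $\kappa:P\to\Gamma$ is a surjective coloring by vertices of a finite simple graph; $a\sim b$ means adjacent. Axioms: (EC) equal-colored elements are comparable; (NA) elements in a covering relation have adjacent colors; (AC) elements with adjacent colors are comparable; (ICE2) if $x<y$ both have color $a$ and no element of color $a$ lies strictly between them, then the interval $(x,y)$ contains exactly two elements whose colors are adjacent to $a$. For an order ideal $I$ and color $a$, $X_a.I=\sum I\cup\{x\}$ over minimal elements $x$ of $P-I$ of color $a$. On the complex vector space with basis the ordered $m$-tuples of order ideals, $X_a.(I_1,\dots,I_m)=\sum_j(I_1,\dots,X_a.I_j,\dots,I_m)$; likewise on the space with basis unordered $m$-multisets of ideals. $\langle a^k\rangle=\frac1{k!}X_a^k$ ($\langle a^0\rangle=\mathrm{id}$), and $\langle d_3^{n_3},d_2^{n_2},d_1^{n_1}\rangle=\langle d_3^{n_3}\rangle\circ\langle d_2^{n_2}\rangle\circ\langle d_1^{n_1}\rangle$. -}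

module Defs where

open import Data.Nat as ℕ using (ℕ; zero; suc; _!)
open import Data.Nat.Properties using (_!≢0)
open import Data.Fin as Fin using (Fin)
open import Data.Fin.Properties using (all?) renaming (_≟_ to _≟ᶠ_)
open import Data.Fin.Subset using (Subset; _∈_; _∉_; _∪_; ⁅_⁆)
open import Data.Fin.Subset.Properties using (_∈?_)
open import Data.Vec as Vec using (Vec; lookup; _[_]≔_; toList)
open import Data.Vec.Properties using (≡-dec)
open import Data.Bool.Properties using () renaming (_≟_ to _≟ᵇ_)
open import Data.List as List using (List; []; _∷_; concatMap; map; filter; foldr; length; _++_)
open import Data.List.Relation.Unary.All as All using (All)
open import Data.Rational using (ℚ; 0ℚ; 1ℚ; _+_; _*_; -_; _/_)
open import Data.Integer using (+_)
open import Data.Product using (Σ; ∃; ∃₂; _×_; _,_; proj₁; proj₂)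
open import Data.Sum using (_⊎_)
open import Function using (_∘_; id)
open import Relation.Nullary using (¬_; Dec)
open import Relation.Nullary.Decidable using (_×-dec_; _→-dec_; ¬?)
open import Relation.Binary.PropositionalEquality using (_≡_; _≢_)

record SimpleGraph (g : ℕ) : Set₁ where
  field
    _∼_      : Fin g → Fin g → Set
    _∼?_     : ∀ a b → Dec (a ∼ b)
    ∼-sym    : ∀ {a b} → a ∼ b → b ∼ a
    ∼-irrefl : ∀ {a} → ¬ (a ∼ a)

record FinPoset (n : ℕ) : Set₁ where
  field
    _≤_       : Fin n → Fin n → Set
    _≤?_      : ∀ x y → Dec (x ≤ y)
    ≤-refl    : ∀ {x} → x ≤ x
    ≤-antisym : ∀ {x y} → x ≤ y → y ≤ x → x ≡ y
    ≤-trans   : ∀ {x y z} → x ≤ y → y ≤ z → x ≤ z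

  _<_ : Fin n → Fin n → Set
  x < y = x ≤ y × x ≢ y

  _<?_ : ∀ x y → Dec (x < y)
  x <? y = (x ≤? y) ×-dec ¬? (x ≟ᶠ y)

  _⋖_ : Fin n → Fin n → Set
  x ⋖ y = x < y × (∀ z → ¬ (x < z × z < y))

  Comparable : Fin n → Fin n → Set
  Comparable x y = x ≤ y ⊎ y ≤ x

-- chains of comparable elements; P is connected iff its comparability
-- graph is connected
data ComparabilityPath {n : ℕ} (P : FinPoset n) : Fin n → Fin n → Set where
  done : ∀ {x} → ComparabilityPath P x x
  step : ∀ {x y z} → FinPoset.Comparable P x y → ComparabilityPath P y z →
         ComparabilityPath P x z

Connected : ∀ {n} → FinPoset n → Set
Connected {n} P = ∀ (x y : Fin n) → ComparabilityPath P x y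

module _ {n g : ℕ} (Γ : SimpleGraph g) (P : FinPoset n) (κ : Fin n → Fin g) where
  open SimpleGraph Γ
  open FinPoset P

  Surjective : Set
  Surjective = ∀ (a : Fin g) → ∃ λ x → κ x ≡ a

  EC : Set
  EC = ∀ x y → κ x ≡ κ y → Comparable x y

  NA : Set
  NA = ∀ x y → x ⋖ y → κ x ∼ κ y

  AC : Set
  AC = ∀ x y → κ x ∼ κ y → Comparable x y

  ExactlyTwo : (Fin n → Set) → Set
  ExactlyTwo Q = ∃₂ λ z₁ z₂ → z₁ ≢ z₂ × Q z₁ × Q z₂ × (∀ z → Q z → z ≡ z₁ ⊎ z ≡ z₂)

  ICE2 : Set
  ICE2 = ∀ x y → x < y → κ x ≡ κ y →
         (∀ z → x < z → z < y → κ z ≢ κ x) →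
         ExactlyTwo (λ z → x < z × z < y × κ z ∼ κ x)

  IsIdeal : Subset n → Set
  IsIdeal I = ∀ {x y} → x ∈ I → y ≤ x → y ∈ I

  MinimalOutside : Fin g → Subset n → Fin n → Set
  MinimalOutside a I x = x ∉ I × κ x ≡ a × (∀ y → y < x → y ∈ I)

  minimalOutside? : ∀ a I x → Dec (MinimalOutside a I x)
  minimalOutside? a I x =
    ¬? (x ∈? I) ×-dec (κ x ≟ᶠ a) ×-dec all? (λ y → (y <? x) →-dec (y ∈? I))

  -- X_a . I  as a formal list of ideals (each with coefficient 1)
  Xideal : Fin g → Subset n → List (Subset n)
  Xideal a I = map (λ x → I ∪ ⁅ x ⁆) (filter (minimalOutside? a I) (List.allFin n))

  Tuple : ℕ → Set
  Tuple m = Vec (Subset n) m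

  FormalSum : ℕ → Set
  FormalSum m = List (ℚ × Tuple m)

  basis : ∀ {m} → Tuple m → FormalSum m
  basis T = (1ℚ , T) ∷ []

  scale : ∀ {m} → ℚ → FormalSum m → FormalSum m
  scale r = map (λ { (s , T) → (r * s , T) })

  extend : ∀ {m} → (Tuple m → FormalSum m) → FormalSum m → FormalSum m
  extend f = concatMap (λ { (r , T) → scale r (f T) })

  Xtuple : ∀ {m} → Fin g → Tuple m → FormalSum m
  Xtuple {m} a T =
    concatMap (λ j → map (λ I′ → (1ℚ , T [ j ]≔ I′)) (Xideal a (lookup T j)))
              (List.allFin m)

  X : ∀ {m} → Fin g → FormalSum m → FormalSum m
  X a = extend (Xtuple a)

  iter : ∀ {A : Set} → ℕ → (A → A) → A → A
  iter zero    f = id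
  iter (suc k) f = f ∘ iter k f

  ⟨_^_⟩ : ∀ {m} → Fin g → ℕ → FormalSum m → FormalSum m
  ⟨ a ^ k ⟩ v = scale ((+ 1 / (k !)) {{k !≢0}}) (iter k (X a) v)

  ⟨_^_,_^_,_^_⟩ : ∀ {m} → Fin g → ℕ → Fin g → ℕ → Fin g → ℕ →
                  FormalSum m → FormalSum m
  ⟨ d₃ ^ n₃ , d₂ ^ n₂ , d₁ ^ n₁ ⟩ = ⟨ d₃ ^ n₃ ⟩ ∘ ⟨ d₂ ^ n₂ ⟩ ∘ ⟨ d₁ ^ n₁ ⟩

  _≟T_ : ∀ {m} (S T : Tuple m) → Dec (S ≡ T)
  _≟T_ = ≡-dec (≡-dec _≟ᵇ_)

  sumℚ : List ℚ → ℚ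
  sumℚ = foldr _+_ 0ℚ

  coeffTuple : ∀ {m} → Tuple m → FormalSum m → ℚ
  coeffTuple J v = sumℚ (map proj₁ (filter (λ e → proj₂ e ≟T J) v))

  -- multisets: two tuples represent the same multiset iff every
  -- subset occurs equally often in both
  count : ∀ {m} → Subset n → Tuple m → ℕ
  count U S = length (filter (λ V → V ≟S U) (toList S))
    where
    _≟S_ : (A B : Subset n) → Dec (A ≡ B)
    _≟S_ = ≡-dec _≟ᵇ_

  SameMultiset : ∀ {m} → Tuple m → Tuple m → Set
  SameMultiset S T = All (λ U → count U S ≡ count U T) (toList S ++ toList T)

  sameMultiset? : ∀ {m} (S T : Tuple m) → Dec (SameMultiset S T)
  sameMultiset? S T = All.all? (λ U → count U S ℕ.≟ count U T) (toList S ++ toList T)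

  -- coefficient of the basis multiset [J] in the image of v in the
  -- space spanned by m-multisets
  coeffMultiset : ∀ {m} → Tuple m → FormalSum m → ℚ
  coeffMultiset J v = sumℚ (map proj₁ (filter (λ e → sameMultiset? (proj₂ e) J) v))

  AllIdeals : ∀ {m} → Tuple m → Set
  AllIdeals T = ∀ j → IsIdeal (lookup T j)

  sign : ℕ → ℚ
  sign zero    = 1ℚ
  sign (suc k) = - sign k

  alternatingSum : ∀ {m} → Fin g → Fin g → ℕ → ℕ → FormalSum m → FormalSum m
  alternatingSum b c p q v =
    concatMap (λ k → scale (sign k) (⟨ c ^ (q ℕ.∸ k) , b ^ p , c ^ k ⟩ v))
              (List.upTo (suc q))

-- Dualise: pair a formal sum v with a weight w on tuples by ⟦ v ⟧ w = Σ r · w(T). Both kinds of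
-- coefficient are pairings with indicator weights, and each ⟨a^k⟩ becomes a transpose ⟨a^k⟩ᵀ acting on
-- weights, so the claim reads Σ_{i+j=q} (-1)^i ⟨c^i⟩ᵀ⟨b^p⟩ᵀ⟨c^j⟩ᵀ = 0 on tuples of ideals. For an ideal I, EC and ICE2 give X_a X_a I = 0 and,
-- since b ≠ c, X_c X_b X_c I = 0. Hence on the first entry ⟨a^k⟩ splits into a part fixing it and a
-- part applying X_a to it once (`expand`). In the expansion of the triple product, terms moving the
-- first entry by both c-factors vanish; every other term either vanishes by induction, because after
-- the shift of the diagonal p or p - 1 is still below it, or is one of the two terms moving the first
-- entry by a single c-factor, which are equal and come with opposite signs.

module Submission where

open import Defs
open import Data.Nat using (ℕ; _≤_; _<_)
open import Data.Fin using (Fin)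
open import Data.Product using (_×_)
open import Data.Rational using (0ℚ)
open import Relation.Binary.PropositionalEquality using (_≡_; _≢_)

open import Algebra.Bundles using (CommutativeRing)
open import Data.Empty using (⊥-elim)
import Data.Fin as Fin
open import Data.Fin.Properties using () renaming (_≟_ to _≟ᶠ_)
open import Data.Fin.Subset using (Subset; _∈_; _∉_; _∪_; ⁅_⁆; _⊆_)
open import Data.Fin.Subset.Properties using (p⊆p∪q; x∈p∪q⁻; x∈p∪q⁺; x∈⁅x⁆; x∈⁅y⁆⇒x≡y)
import Data.Integer as ℤ
import Data.Integer.Properties as ℤₚ
open import Data.List using (List; []; _∷_; map; filter; foldr; concatMap; _++_; upTo; applyUpTo; allFin)
open import Data.List.Membership.Propositional using () renaming (_∈_ to _∈ₗ_)
open import Data.List.Membership.Propositional.Properties using (∈-map⁻; ∈-filter⁻)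
open import Data.List.Properties using (map-applyUpTo; map-tabulate; filter-none)
import Data.List.Relation.Unary.All as All
open import Data.List.Relation.Unary.Any using (here; there)
open import Data.Nat using (zero; suc; _!; _∸_; NonZero; s≤s)
open import Data.Nat.Properties using (_!≢0; m<n⇒m<1+n)
open import Data.Product using (_,_; proj₁; proj₂; ∃)
open import Data.Rational using (ℚ; 1ℚ; _+_; _*_; -_; _-_; _/_; toℚᵘ)
open import Data.Rational.Properties
  using ( +-identityˡ; +-identityʳ; +-assoc; +-inverseʳ; *-identityˡ; *-identityʳ; *-zeroʳ; *-assoc
        ; *-distribˡ-+; neg-distrib-+; neg-distribˡ-*; +-*-commutativeRing
        ; toℚᵘ-injective; toℚᵘ-fromℚᵘ; toℚᵘ-homo-+; toℚᵘ-homo-* )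
open import Data.Rational.Solver using (module +-*-Solver)
open import Data.Rational.Unnormalised as ℚᵘ using (mkℚᵘ; *≡*) renaming (_≃_ to _≃ᵘ_)
import Data.Rational.Unnormalised.Properties as ℚᵘₚ
open import Data.Sum using (inj₁; inj₂)
open import Data.Vec using ([]; _∷_; lookup; _[_]≔_)
open import Function using (_∘_)
open import Relation.Binary.PropositionalEquality
  using (refl; sym; trans; cong; cong₂; subst; _≗_; module ≡-Reasoning)
open import Relation.Nullary using (Dec; yes; no; ¬_)
open import Relation.Unary using (Decidable)

open import Algebra.Properties.Semiring.Mult (CommutativeRing.semiring +-*-commutativeRing)
  using (×-assoc-*; ×1-homo-*) renaming (_×_ to _·_)
open +-*-Solver using (solve; con; _:+_; _:*_; _:-_; _:=_)

private
  variable
    A B : Set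

∑ : List A → (A → ℚ) → ℚ
∑ xs f = foldr _+_ 0ℚ (map f xs)

𝟙 : Dec A → ℚ
𝟙 (yes _) = 1ℚ
𝟙 (no _)  = 0ℚ

∑-cong : ∀ xs {f g : A → ℚ} → (∀ x → x ∈ₗ xs → f x ≡ g x) → ∑ xs f ≡ ∑ xs g
∑-cong []       eq = refl
∑-cong (x ∷ xs) eq = cong₂ _+_ (eq x (here refl)) (∑-cong xs (λ y y∈xs → eq y (there y∈xs)))

∑-zero : ∀ xs {f : A → ℚ} → (∀ x → x ∈ₗ xs → f x ≡ 0ℚ) → ∑ xs f ≡ 0ℚ
∑-zero xs eq = trans (∑-cong xs eq) (∑-0 xs)
  where
  ∑-0 : ∀ xs → ∑ xs (λ (_ : A) → 0ℚ) ≡ 0ℚ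
  ∑-0 []       = refl
  ∑-0 (_ ∷ xs) = trans (+-identityˡ _) (∑-0 xs)

∑-+ : ∀ xs (f g : A → ℚ) → ∑ xs (λ x → f x + g x) ≡ ∑ xs f + ∑ xs g
∑-+ []       f g = refl
∑-+ (x ∷ xs) f g = trans (cong ((f x + g x) +_) (∑-+ xs f g))
  (solve 4 (λ a b c d → (a :+ b) :+ (c :+ d) := (a :+ c) :+ (b :+ d)) refl
    (f x) (g x) (∑ xs f) (∑ xs g))

∑-* : ∀ xs r (f : A → ℚ) → ∑ xs (λ x → r * f x) ≡ r * ∑ xs f
∑-* []       r f = sym (*-zeroʳ r)
∑-* (x ∷ xs) r f = trans (cong (r * f x +_) (∑-* xs r f)) (sym (*-distribˡ-+ r (f x) (∑ xs f)))

∑-++ : ∀ xs ys (f : A → ℚ) → ∑ (xs ++ ys) f ≡ ∑ xs f + ∑ ys f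
∑-++ []       ys f = sym (+-identityˡ _)
∑-++ (x ∷ xs) ys f = trans (cong (f x +_) (∑-++ xs ys f)) (sym (+-assoc (f x) _ _))

∑-map : ∀ (xs : List A) (h : A → B) f → ∑ (map h xs) f ≡ ∑ xs (f ∘ h)
∑-map []       h f = refl
∑-map (x ∷ xs) h f = cong (f (h x) +_) (∑-map xs h f)

∑-concatMap : ∀ (xs : List A) (h : A → List B) f → ∑ (concatMap h xs) f ≡ ∑ xs (λ x → ∑ (h x) f)
∑-concatMap []       h f = refl
∑-concatMap (x ∷ xs) h f = trans (∑-++ (h x) (concatMap h xs) f) (cong (∑ (h x) f +_) (∑-concatMap xs h f))

∑-filter : ∀ {P : A → Set} (P? : Decidable P) xs f → ∑ (filter P? xs) f ≡ ∑ xs (λ x → f x * 𝟙 (P? x))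
∑-filter P? []       f = refl
∑-filter P? (x ∷ xs) f with P? x
... | yes _ = cong₂ _+_ (sym (*-identityʳ (f x))) (∑-filter P? xs f)
... | no _  = trans (∑-filter P? xs f) (sym (trans (cong (_+ _) (*-zeroʳ (f x))) (+-identityˡ _)))

∑-neg : ∀ (xs : List A) f → ∑ xs (λ x → - f x) ≡ - ∑ xs f
∑-neg []       f = refl
∑-neg (x ∷ xs) f = trans (cong (- f x +_) (∑-neg xs f)) (sym (neg-distrib-+ (f x) (∑ xs f)))

∑-allFin : ∀ m (f : Fin (suc m) → ℚ) → ∑ (allFin (suc m)) f ≡ f Fin.zero + ∑ (allFin m) (f ∘ Fin.suc)
∑-allFin m f = cong (f Fin.zero +_) (trans (cong (λ xs → ∑ xs f) (sym (map-tabulate (λ i → i) Fin.suc)))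
                                           (∑-map (allFin m) Fin.suc f))

-- f (k - 1), read as 0 when k = 0: this encodes the convention ⟨a^-1⟩ = 0.
atPred : ℕ → (ℕ → ℚ) → ℚ
atPred zero    f = 0ℚ
atPred (suc k) f = f k

atPred-cong : ∀ k {f g : ℕ → ℚ} → (∀ j → suc j ≡ k → f j ≡ g j) → atPred k f ≡ atPred k g
atPred-cong zero    eq = refl
atPred-cong (suc k) eq = eq k refl

-- altDiag F q = Σ_{i + j = q} (-1)^i F i j
altDiag : (ℕ → ℕ → ℚ) → ℕ → ℚ
altDiag F zero    = F 0 0
altDiag F (suc q) = F 0 (suc q) - altDiag (λ i → F (suc i)) q

altDiag-cong : ∀ q {F G : ℕ → ℕ → ℚ} → (∀ i j → F i j ≡ G i j) → altDiag F q ≡ altDiag G q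
altDiag-cong zero    eq = eq 0 0
altDiag-cong (suc q) eq = cong₂ _-_ (eq 0 (suc q)) (altDiag-cong q (λ i → eq (suc i)))

altDiag-zero : ∀ q {F : ℕ → ℕ → ℚ} → (∀ i j → F i j ≡ 0ℚ) → altDiag F q ≡ 0ℚ
altDiag-zero zero    eq = eq 0 0
altDiag-zero (suc q) eq = cong₂ _-_ (eq 0 (suc q)) (altDiag-zero q (λ i → eq (suc i)))

altDiag-+ : ∀ q (F G : ℕ → ℕ → ℚ) → altDiag (λ i j → F i j + G i j) q ≡ altDiag F q + altDiag G q
altDiag-+ zero    F G = refl
altDiag-+ (suc q) F G = trans (cong (λ z → F 0 (suc q) + G 0 (suc q) - z) (altDiag-+ q _ _))
  (solve 4 (λ a b c d → (a :+ b) :- (c :+ d) := (a :- c) :+ (b :- d)) refl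
    (F 0 (suc q)) (G 0 (suc q)) (altDiag (λ i → F (suc i)) q) (altDiag (λ i → G (suc i)) q))

altDiag-∑ : ∀ q (xs : List A) (F : A → ℕ → ℕ → ℚ) →
            altDiag (λ i j → ∑ xs (λ x → F x i j)) q ≡ ∑ xs (λ x → altDiag (F x) q)
altDiag-∑ q []       F = altDiag-zero q (λ _ _ → refl)
altDiag-∑ q (x ∷ xs) F = trans (altDiag-+ q (F x) _) (cong (altDiag (F x) q +_) (altDiag-∑ q xs F))

altDiag-atPred : ∀ q k (F : ℕ → ℕ → ℕ → ℚ) →
                 altDiag (λ i j → atPred k (λ l → F l i j)) q ≡ atPred k (λ l → altDiag (F l) q)
altDiag-atPred q zero    F = altDiag-zero q (λ _ _ → refl)
altDiag-atPred q (suc k) F = refl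

altDiag-atPredʳ : ∀ q (F : ℕ → ℕ → ℚ) → altDiag (λ i j → atPred j (F i)) (suc q) ≡ altDiag F q
altDiag-atPredʳ zero    F = +-identityʳ (F 0 0)
altDiag-atPredʳ (suc q) F = cong (λ z → F 0 (suc q) - z) (altDiag-atPredʳ q (λ i → F (suc i)))

altDiag-atPredˡ : ∀ q (F : ℕ → ℕ → ℚ) →
                  altDiag (λ i j → atPred i (λ i′ → F i′ j)) (suc q) ≡ - altDiag F q
altDiag-atPredˡ q F = +-identityˡ _

-- Dual of ⟨a^k⟩(I, T) = (I, ⟨a^k⟩ T) + (X_a I, ⟨a^(k-1)⟩ T), which holds when X_a X_a I = 0.
expand : (A → List A) → ℕ → (ℕ → A → ℚ) → A → ℚ
expand next k φ x = φ k x + atPred k (λ j → ∑ (next x) (φ j))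

module _ (next : A → List A) where

  expand-cong : ∀ k x {φ ψ : ℕ → A → ℚ} → φ k x ≡ ψ k x →
                (∀ j → suc j ≡ k → ∀ y → y ∈ₗ next x → φ j y ≡ ψ j y) →
                expand next k φ x ≡ expand next k ψ x
  expand-cong k x eq₀ eq = cong₂ _+_ eq₀ (atPred-cong k (λ j sj≡k → ∑-cong (next x) (eq j sj≡k)))

  expand-head : ∀ k x {φ : ℕ → A → ℚ} → (∀ j → suc j ≡ k → ∀ y → y ∈ₗ next x → φ j y ≡ 0ℚ) →
                expand next k φ x ≡ φ k x
  expand-head k x {φ} eq =
    trans (cong (φ k x +_) (trans (atPred-cong k (λ j sj≡k → ∑-zero (next x) (eq j sj≡k)))
                                  (atPred-0 k)))
          (+-identityʳ (φ k x))
    where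
    atPred-0 : ∀ k → atPred k (λ _ → 0ℚ) ≡ 0ℚ
    atPred-0 zero    = refl
    atPred-0 (suc k) = refl

  expand-[] : ∀ k x {φ : ℕ → A → ℚ} → next x ≡ [] → expand next k φ x ≡ φ k x
  expand-[] k x {φ} next-x≡[] =
    expand-head k x {φ} (λ j _ y y∈ → ⊥-elim (∉[] (subst (y ∈ₗ_) next-x≡[] y∈)))
    where
    ∉[] : ∀ {y} → ¬ y ∈ₗ []
    ∉[] ()

  altDiag-expand : ∀ q k x (φ : ℕ → A → ℕ → ℕ → ℚ) →
    altDiag (λ i j → expand next k (λ l y → φ l y i j) x) q ≡ expand next k (λ l y → altDiag (φ l y) q) x
  altDiag-expand q k x φ =
    trans (altDiag-+ q (φ k x) _)
          (cong (altDiag (φ k x) q +_)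
                (trans (altDiag-atPred q k (λ l i j → ∑ (next x) (λ y → φ l y i j)))
                       (atPred-cong k (λ l _ → altDiag-∑ q (next x) (φ l)))))

  altDiag-expandʳ : ∀ q x (φ : ℕ → ℕ → A → ℚ) →
    altDiag (λ i j → expand next j (φ i) x) (suc q) ≡
    altDiag (λ i j → φ i j x) (suc q) + ∑ (next x) (λ y → altDiag (λ i j → φ i j y) q)
  altDiag-expandʳ q x φ =
    trans (altDiag-+ (suc q) (λ i j → φ i j x) (λ i j → atPred j (λ l → ∑ (next x) (φ i l))))
          (cong (altDiag (λ i j → φ i j x) (suc q) +_)
                (trans (altDiag-atPredʳ q (λ i j → ∑ (next x) (φ i j)))
                       (altDiag-∑ q (next x) (λ y i j → φ i j y))))

  altDiag-expandˡ : ∀ q x (φ : ℕ → ℕ → A → ℚ) →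
    altDiag (λ i j → expand next i (λ i′ → φ i′ j) x) (suc q) ≡
    altDiag (λ i j → φ i j x) (suc q) - ∑ (next x) (λ y → altDiag (λ i j → φ i j y) q)
  altDiag-expandˡ q x φ =
    trans (altDiag-+ (suc q) (λ i j → φ i j x) (λ i j → atPred i (λ l → ∑ (next x) (λ y → φ l j y))))
          (cong (altDiag (λ i j → φ i j x) (suc q) +_)
                (trans (altDiag-atPredˡ q (λ i j → ∑ (next x) (λ y → φ i j y)))
                       (cong -_ (altDiag-∑ q (next x) (λ y i j → φ i j y)))))

inv! : ℕ → ℚ
inv! k = (ℤ.+ 1 / k !) {{k !≢0}}

toℚᵘ-·1 : ∀ n → toℚᵘ (n · 1ℚ) ≃ᵘ mkℚᵘ (ℤ.+ n) 0
toℚᵘ-·1 zero    = ℚᵘₚ.≃-refl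
toℚᵘ-·1 (suc n) = ℚᵘₚ.≃-trans (toℚᵘ-homo-+ 1ℚ (n · 1ℚ))
  (ℚᵘₚ.≃-trans (ℚᵘₚ.+-congʳ ℚᵘ.1ℚᵘ (toℚᵘ-·1 n))
               (*≡* (cong (λ i → (ℤ.+ 1 ℤ.+ i) ℤ.* ℤ.+ 1) (ℤₚ.*-identityʳ (ℤ.+ n)))))

-- + 1 / n is normalised through a gcd, so it is compared in ℚᵘ, where it is literally 1/n.
1/n*n·1≡1 : ∀ n .{{_ : NonZero n}} → (ℤ.+ 1 / n) * (n · 1ℚ) ≡ 1ℚ
1/n*n·1≡1 (suc n) = toℚᵘ-injective (ℚᵘₚ.≃-trans (toℚᵘ-homo-* (ℤ.+ 1 / suc n) (suc n · 1ℚ))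
  (ℚᵘₚ.≃-trans (ℚᵘₚ.*-cong (toℚᵘ-fromℚᵘ (mkℚᵘ (ℤ.+ 1) n)) (toℚᵘ-·1 (suc n)))
              (ℚᵘₚ.*-inverseˡ (mkℚᵘ (ℤ.+ suc n) 0))))

inv!-step : ∀ k x → inv! (suc k) * (suc k · x) ≡ inv! k * x
inv!-step k x = begin
  u * (suc k · x)               ≡⟨ cong (u *_) (trans (cong (suc k ·_) (sym (*-identityˡ x)))
                                                      (sym (×-assoc-* (suc k) 1ℚ x))) ⟩
  u * (s * x)                   ≡⟨ cong (λ e → u * (s * e)) (trans (sym (*-identityˡ x))
                                                      (cong (_* x) (sym (1/n*n·1≡1 (k !) {{k !≢0}})))) ⟩
  u * (s * ((v * t) * x))       ≡⟨ solve 5 (λ u s v t x → u :* (s :* ((v :* t) :* x)) := (u :* (s :* t)) :* (v :* x))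
                                           refl u s v t x ⟩
  (u * (s * t)) * (v * x)       ≡⟨ cong (λ e → (u * e) * (v * x)) (sym (×1-homo-* (suc k) (k !))) ⟩
  (u * ((suc k !) · 1ℚ)) * (v * x) ≡⟨ cong (_* (v * x)) (1/n*n·1≡1 (suc k !) {{suc k !≢0}}) ⟩
  1ℚ * (v * x)                  ≡⟨ *-identityˡ (v * x) ⟩
  v * x                         ∎
  where
  open ≡-Reasoning
  u v s t : ℚ
  u = inv! (suc k)
  v = inv! k
  s = suc k · 1ℚ
  t = (k !) · 1ℚ

module Transposes {n g : ℕ} (Γ : SimpleGraph g) (P : FinPoset n) (κ : Fin n → Fin g) where

  private
    variable
      m : ℕ

  W : ℕ → Set
  W m = Tuple Γ P κ m → ℚ

  Xid : Fin g → Subset n → List (Subset n)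
  Xid = Xideal Γ P κ

  weigh : W m → ℚ × Tuple Γ P κ m → ℚ
  weigh w e = proj₁ e * w (proj₂ e)

  ⟦_⟧ : FormalSum Γ P κ m → W m → ℚ
  ⟦ v ⟧ w = ∑ v (weigh w)

  fiber : W (suc m) → Subset n → W m
  fiber w I U = w (I ∷ U)

  Xᵀ : Fin g → W m → W m
  Xᵀ a w []      = 0ℚ
  Xᵀ a w (I ∷ T) = ∑ (Xid a I) (λ J → w (J ∷ T)) + Xᵀ a (fiber w I) T

  Xᵀ^ : Fin g → ℕ → W m → W m
  Xᵀ^ a zero    w = w
  Xᵀ^ a (suc k) w = Xᵀ^ a k (Xᵀ a w)

  ⟨_^_⟩ᵀ : Fin g → ℕ → W m → W m
  ⟨ a ^ k ⟩ᵀ w T = inv! k * Xᵀ^ a k w T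

  ⟦⟧-cong : ∀ (v : FormalSum Γ P κ m) {w w′} → w ≗ w′ → ⟦ v ⟧ w ≡ ⟦ v ⟧ w′
  ⟦⟧-cong v eq = ∑-cong v (λ e _ → cong (proj₁ e *_) (eq (proj₂ e)))

  ⟦⟧-* : ∀ (v : FormalSum Γ P κ m) r w → ⟦ v ⟧ (λ T → r * w T) ≡ r * ⟦ v ⟧ w
  ⟦⟧-* v r w =
    trans (∑-cong v (λ e _ → solve 3 (λ s r x → s :* (r :* x) := r :* (s :* x)) refl (proj₁ e) r (w (proj₂ e))))
          (∑-* v r (weigh w))

  ⟦scale⟧ : ∀ r (v : FormalSum Γ P κ m) w → ⟦ scale Γ P κ r v ⟧ w ≡ r * ⟦ v ⟧ w
  ⟦scale⟧ r v w = trans (∑-map v _ _) (trans (∑-cong v (λ e _ → *-assoc r (proj₁ e) _)) (∑-* v r _))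

  ⟦extend⟧ : ∀ (f : Tuple Γ P κ m → FormalSum Γ P κ m) v w →
             ⟦ extend Γ P κ f v ⟧ w ≡ ⟦ v ⟧ (λ T → ⟦ f T ⟧ w)
  ⟦extend⟧ f v w = trans (∑-concatMap v _ _) (∑-cong v (λ e _ → ⟦scale⟧ (proj₁ e) (f (proj₂ e)) w))

  ⟦basis⟧ : ∀ (T : Tuple Γ P κ m) w → ⟦ basis Γ P κ T ⟧ w ≡ w T
  ⟦basis⟧ T w = trans (+-identityʳ _) (*-identityˡ _)

  ⟦Xtuple⟧ : ∀ a (T : Tuple Γ P κ m) w → ⟦ Xtuple Γ P κ a T ⟧ w ≡ Xᵀ a w T
  ⟦Xtuple⟧ {m} a T w =
    trans (∑-concatMap (allFin m) (λ j → map (λ J → 1ℚ , T [ j ]≔ J) (Xid a (lookup T j))) (weigh w))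
    (trans (∑-cong (allFin m) (λ j _ →
              trans (∑-map (Xid a (lookup T j)) (λ J → 1ℚ , T [ j ]≔ J) (weigh w))
                    (∑-cong (Xid a (lookup T j)) (λ J _ → *-identityˡ (w (T [ j ]≔ J))))))
           (by-positions T w))
    where
    by-positions : ∀ {m} (T : Tuple Γ P κ m) w →
      ∑ (allFin m) (λ j → ∑ (Xid a (lookup T j)) (λ J → w (T [ j ]≔ J))) ≡ Xᵀ a w T
    by-positions []      w = refl
    by-positions {suc m} (I ∷ T) w =
      trans (∑-allFin m (λ j → ∑ (Xid a (lookup (I ∷ T) j)) (λ J → w ((I ∷ T) [ j ]≔ J))))
            (cong (∑ (Xid a I) (λ J → w (J ∷ T)) +_) (by-positions T (fiber w I)))

  ⟦X⟧ : ∀ a (v : FormalSum Γ P κ m) w → ⟦ X Γ P κ a v ⟧ w ≡ ⟦ v ⟧ (Xᵀ a w)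
  ⟦X⟧ a v w = trans (⟦extend⟧ (Xtuple Γ P κ a) v w) (⟦⟧-cong v (λ T → ⟦Xtuple⟧ a T w))

  ⟦⟨^⟩⟧ : ∀ a k (v : FormalSum Γ P κ m) w → ⟦ ⟨_^_⟩ Γ P κ a k v ⟧ w ≡ ⟦ v ⟧ (⟨ a ^ k ⟩ᵀ w)
  ⟦⟨^⟩⟧ a k v w =
    trans (⟦scale⟧ (inv! k) (iter Γ P κ k (X Γ P κ a) v) w)
          (trans (cong (inv! k *_) (⟦iter⟧ k w)) (sym (⟦⟧-* v (inv! k) (Xᵀ^ a k w))))
    where
    ⟦iter⟧ : ∀ k w → ⟦ iter Γ P κ k (X Γ P κ a) v ⟧ w ≡ ⟦ v ⟧ (Xᵀ^ a k w)
    ⟦iter⟧ zero    w = refl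
    ⟦iter⟧ (suc k) w = trans (⟦X⟧ a (iter Γ P κ k (X Γ P κ a) v) w) (⟦iter⟧ k (Xᵀ a w))

  record IsLinear (O : W m → W m) : Set where
    field
      resp-≗ : ∀ {f f′} → f ≗ f′ → O f ≗ O f′
      +-homo : ∀ f f′ → O (λ U → f U + f′ U) ≗ λ T → O f T + O f′ T
      0-homo : O (λ _ → 0ℚ) ≗ λ _ → 0ℚ

    ∑-homo : ∀ (xs : List A) (f : A → W m) →
             O (λ U → ∑ xs (λ x → f x U)) ≗ λ T → ∑ xs (λ x → O (f x) T)
    ∑-homo []       f T = 0-homo T
    ∑-homo (x ∷ xs) f T = trans (+-homo (f x) _ T) (cong (O (f x) T +_) (∑-homo xs f T))

    expand-homo : ∀ (next : A → List A) k x (φ : ℕ → A → W m) →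
      O (λ U → expand next k (λ j y → φ j y U) x) ≗ λ T → expand next k (λ j y → O (φ j y) T) x
    expand-homo next zero    x φ T = trans (+-homo (φ 0 x) _ T) (cong (O (φ 0 x) T +_) (0-homo T))
    expand-homo next (suc k) x φ T =
      trans (+-homo (φ (suc k) x) _ T) (cong (O (φ (suc k) x) T +_) (∑-homo (next x) (φ k) T))

  open IsLinear

  id-linear : IsLinear {m} (λ w → w)
  id-linear = record { resp-≗ = λ eq → eq ; +-homo = λ _ _ _ → refl ; 0-homo = λ _ → refl }

  ∘-linear : ∀ {O O′ : W m → W m} → IsLinear O → IsLinear O′ → IsLinear (λ w → O (O′ w))
  ∘-linear L L′ = record
    { resp-≗ = λ eq → resp-≗ L (resp-≗ L′ eq)
    ; +-homo = λ f f′ T → trans (resp-≗ L (+-homo L′ f f′) T) (+-homo L _ _ T)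
    ; 0-homo = λ T → trans (resp-≗ L (0-homo L′) T) (0-homo L T)
    }

  Xᵀ-linear : ∀ a → IsLinear {m} (Xᵀ a)
  Xᵀ-linear a = record { resp-≗ = resp ; +-homo = homo ; 0-homo = zero-homo }
    where
    resp : ∀ {m} {f f′ : W m} → f ≗ f′ → Xᵀ a f ≗ Xᵀ a f′
    resp eq []      = refl
    resp eq (I ∷ T) = cong₂ _+_ (∑-cong (Xid a I) (λ J _ → eq (J ∷ T))) (resp (λ U → eq (I ∷ U)) T)

    homo : ∀ {m} (f f′ : W m) → Xᵀ a (λ U → f U + f′ U) ≗ λ T → Xᵀ a f T + Xᵀ a f′ T
    homo f f′ []      = sym (+-identityʳ 0ℚ)
    homo f f′ (I ∷ T) =
      trans (cong₂ _+_ (∑-+ (Xid a I) (λ J → f (J ∷ T)) (λ J → f′ (J ∷ T)))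
                       (homo (fiber f I) (fiber f′ I) T))
            (solve 4 (λ x x′ y y′ → (x :+ x′) :+ (y :+ y′) := (x :+ y) :+ (x′ :+ y′)) refl
                   (∑ (Xid a I) (λ J → f (J ∷ T))) (∑ (Xid a I) (λ J → f′ (J ∷ T)))
                   (Xᵀ a (fiber f I) T) (Xᵀ a (fiber f′ I) T))

    zero-homo : ∀ {m} → Xᵀ {m} a (λ _ → 0ℚ) ≗ λ _ → 0ℚ
    zero-homo []      = refl
    zero-homo (I ∷ T) = trans (cong₂ _+_ (∑-zero (Xid a I) (λ _ _ → refl)) (zero-homo T)) (+-identityʳ 0ℚ)

  Xᵀ^-linear : ∀ a k → IsLinear {m} (Xᵀ^ a k)
  Xᵀ^-linear a zero    = id-linear
  Xᵀ^-linear a (suc k) = ∘-linear (Xᵀ^-linear a k) (Xᵀ-linear a)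

  ⟨^⟩ᵀ-linear : ∀ a k → IsLinear {m} ⟨ a ^ k ⟩ᵀ
  ⟨^⟩ᵀ-linear a k = record
    { resp-≗ = λ eq T → cong (inv! k *_) (resp-≗ L eq T)
    ; +-homo = λ f f′ T → trans (cong (inv! k *_) (+-homo L f f′ T)) (*-distribˡ-+ (inv! k) _ _)
    ; 0-homo = λ T → trans (cong (inv! k *_) (0-homo L T)) (*-zeroʳ (inv! k))
    }
    where
    L : IsLinear (Xᵀ^ a k)
    L = Xᵀ^-linear a k

  Xᵀ^-head : ∀ a I → (∀ J → J ∈ₗ Xid a I → Xid a J ≡ []) → ∀ k (w : W (suc m)) T →
    Xᵀ^ a (suc k) w (I ∷ T) ≡
    Xᵀ^ a (suc k) (fiber w I) T + suc k · ∑ (Xid a I) (λ J → Xᵀ^ a k (fiber w J) T)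
  Xᵀ^-head a I nil zero w T =
    solve 2 (λ x y → x :+ y := y :+ (x :+ con 0ℚ)) refl (∑ (Xid a I) (λ J → w (J ∷ T))) (Xᵀ a (fiber w I) T)
  Xᵀ^-head a I nil (suc k) w T = begin
    Xᵀ^ a (suc k) (Xᵀ a w) (I ∷ T)
      ≡⟨ Xᵀ^-head a I nil k (Xᵀ a w) T ⟩
    Xᵀ^ a (suc k) (fiber (Xᵀ a w) I) T + suc k · ∑ (Xid a I) (λ J → Xᵀ^ a k (fiber (Xᵀ a w) J) T)
      ≡⟨ cong₂ (λ x y → x + suc k · y) head tail ⟩
    (S + Xᵀ^ a (suc (suc k)) (fiber w I) T) + suc k · S
      ≡⟨ solve 3 (λ s x t → (s :+ x) :+ t := x :+ (s :+ t)) refl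
                 S (Xᵀ^ a (suc (suc k)) (fiber w I) T) (suc k · S) ⟩
    Xᵀ^ a (suc (suc k)) (fiber w I) T + suc (suc k) · S ∎
    where
    open ≡-Reasoning
    L : IsLinear (Xᵀ^ a (suc k))
    L = Xᵀ^-linear a (suc k)
    S : ℚ
    S = ∑ (Xid a I) (λ J → Xᵀ^ a (suc k) (fiber w J) T)
    head : Xᵀ^ a (suc k) (fiber (Xᵀ a w) I) T ≡ S + Xᵀ^ a (suc (suc k)) (fiber w I) T
    head = trans (+-homo L (λ U → ∑ (Xid a I) (λ J → w (J ∷ U))) (Xᵀ a (fiber w I)) T)
                 (cong (_+ Xᵀ^ a (suc (suc k)) (fiber w I) T) (∑-homo L (Xid a I) (fiber w) T))
    tail : ∑ (Xid a I) (λ J → Xᵀ^ a k (fiber (Xᵀ a w) J) T) ≡ S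
    tail = ∑-cong (Xid a I) (λ J J∈ → resp-≗ (Xᵀ^-linear a k)
             (λ U → trans (cong (λ Js → ∑ Js (λ J′ → w (J′ ∷ U)) + Xᵀ a (fiber w J) U) (nil J J∈))
                          (+-identityˡ _)) T)

  ⟨^⟩ᵀ-head : ∀ a I → (∀ J → J ∈ₗ Xid a I → Xid a J ≡ []) → ∀ k (w : W (suc m)) T →
    ⟨ a ^ k ⟩ᵀ w (I ∷ T) ≡ expand (Xid a) k (λ j J → ⟨ a ^ j ⟩ᵀ (fiber w J) T) I
  ⟨^⟩ᵀ-head a I nil zero    w T = sym (+-identityʳ _)
  ⟨^⟩ᵀ-head a I nil (suc k) w T = begin
    inv! (suc k) * Xᵀ^ a (suc k) w (I ∷ T)
      ≡⟨ cong (inv! (suc k) *_) (Xᵀ^-head a I nil k w T) ⟩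
    inv! (suc k) * (Xᵀ^ a (suc k) (fiber w I) T + suc k · S)
      ≡⟨ *-distribˡ-+ (inv! (suc k)) _ _ ⟩
    ⟨ a ^ suc k ⟩ᵀ (fiber w I) T + inv! (suc k) * (suc k · S)
      ≡⟨ cong (⟨ a ^ suc k ⟩ᵀ (fiber w I) T +_) (trans (inv!-step k S) (sym (∑-* (Xid a I) (inv! k) _))) ⟩
    expand (Xid a) (suc k) (λ j J → ⟨ a ^ j ⟩ᵀ (fiber w J) T) I ∎
    where
    open ≡-Reasoning
    S : ℚ
    S = ∑ (Xid a I) (λ J → Xᵀ^ a k (fiber w J) T)

  Xᵀ^-[] : ∀ a k (w : W 0) → w [] ≡ 0ℚ → Xᵀ^ a k w [] ≡ 0ℚ
  Xᵀ^-[] a zero    w w[]≡0 = w[]≡0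
  Xᵀ^-[] a (suc k) w _     = Xᵀ^-[] a k (Xᵀ a w) refl

  ⟨^⟩ᵀ-[] : ∀ a k (w : W 0) → w [] ≡ 0ℚ → ⟨ a ^ k ⟩ᵀ w [] ≡ 0ℚ
  ⟨^⟩ᵀ-[] a k w w[]≡0 = trans (cong (inv! k *_) (Xᵀ^-[] a k w w[]≡0)) (*-zeroʳ (inv! k))

  ⟨^suc⟩ᵀ-[] : ∀ a k (w : W 0) → ⟨ a ^ suc k ⟩ᵀ w [] ≡ 0ℚ
  ⟨^suc⟩ᵀ-[] a k w = trans (cong (inv! (suc k) *_) (Xᵀ^-[] a k (Xᵀ a w) refl)) (*-zeroʳ (inv! (suc k)))

  ∑-sign≡altDiag : ∀ q (F : ℕ → ℕ → ℚ) →
                   ∑ (upTo (suc q)) (λ k → sign Γ P κ k * F k (q ∸ k)) ≡ altDiag F q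
  ∑-sign≡altDiag zero    F = trans (+-identityʳ _) (*-identityˡ (F 0 0))
  ∑-sign≡altDiag (suc q) F = cong₂ _+_ (*-identityˡ (F 0 (suc q))) (begin
      ∑ (applyUpTo suc (suc q)) h
    ≡⟨ cong (λ ks → ∑ ks h) (sym (map-applyUpTo (λ k → k) suc (suc q))) ⟩
      ∑ (map suc (upTo (suc q))) h
    ≡⟨ ∑-map (upTo (suc q)) suc h ⟩
      ∑ (upTo (suc q)) (λ k → - sign Γ P κ k * F (suc k) (q ∸ k))
    ≡⟨ ∑-cong (upTo (suc q)) (λ k _ → sym (neg-distribˡ-* (sign Γ P κ k) (F (suc k) (q ∸ k)))) ⟩
      ∑ (upTo (suc q)) (λ k → - (sign Γ P κ k * F (suc k) (q ∸ k)))
    ≡⟨ ∑-neg (upTo (suc q)) (λ k → sign Γ P κ k * F (suc k) (q ∸ k)) ⟩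
      - ∑ (upTo (suc q)) (λ k → sign Γ P κ k * F (suc k) (q ∸ k))
    ≡⟨ cong -_ (∑-sign≡altDiag q (λ i → F (suc i))) ⟩
      - altDiag (λ i → F (suc i)) q ∎)
    where
    open ≡-Reasoning
    h : ℕ → ℚ
    h k = sign Γ P κ k * F k (suc q ∸ k)

  ⟦alternatingSum⟧ : ∀ b c p q (T : Tuple Γ P κ m) w →
    ⟦ alternatingSum Γ P κ b c p q (basis Γ P κ T) ⟧ w ≡
    altDiag (λ i j → ⟨ c ^ i ⟩ᵀ (⟨ b ^ p ⟩ᵀ (⟨ c ^ j ⟩ᵀ w)) T) q
  ⟦alternatingSum⟧ b c p q T w =
    trans (∑-concatMap (upTo (suc q)) (λ k → scale Γ P κ (sign Γ P κ k) (term k)) (weigh w))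
    (trans (∑-cong (upTo (suc q)) (λ k _ → trans (⟦scale⟧ (sign Γ P κ k) (term k) w)
                                                (cong (sign Γ P κ k *_) (⟦term⟧ k))))
           (∑-sign≡altDiag q (λ i j → ⟨ c ^ i ⟩ᵀ (⟨ b ^ p ⟩ᵀ (⟨ c ^ j ⟩ᵀ w)) T)))
    where
    term : ℕ → FormalSum Γ P κ _
    term k = ⟨_^_,_^_,_^_⟩ Γ P κ c (q ∸ k) b p c k (basis Γ P κ T)
    ⟦term⟧ : ∀ k → ⟦ term k ⟧ w ≡ ⟨ c ^ k ⟩ᵀ (⟨ b ^ p ⟩ᵀ (⟨ c ^ (q ∸ k) ⟩ᵀ w)) T
    ⟦term⟧ k = begin
      ⟦ term k ⟧ w
        ≡⟨ ⟦⟨^⟩⟧ c (q ∸ k) _ w ⟩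
      ⟦ ⟨_^_⟩ Γ P κ b p (⟨_^_⟩ Γ P κ c k (basis Γ P κ T)) ⟧ (⟨ c ^ (q ∸ k) ⟩ᵀ w)
        ≡⟨ ⟦⟨^⟩⟧ b p _ _ ⟩
      ⟦ ⟨_^_⟩ Γ P κ c k (basis Γ P κ T) ⟧ (⟨ b ^ p ⟩ᵀ (⟨ c ^ (q ∸ k) ⟩ᵀ w))
        ≡⟨ ⟦⟨^⟩⟧ c k _ _ ⟩
      ⟦ basis Γ P κ T ⟧ (⟨ c ^ k ⟩ᵀ (⟨ b ^ p ⟩ᵀ (⟨ c ^ (q ∸ k) ⟩ᵀ w)))
        ≡⟨ ⟦basis⟧ T (⟨ c ^ k ⟩ᵀ (⟨ b ^ p ⟩ᵀ (⟨ c ^ (q ∸ k) ⟩ᵀ w))) ⟩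
      ⟨ c ^ k ⟩ᵀ (⟨ b ^ p ⟩ᵀ (⟨ c ^ (q ∸ k) ⟩ᵀ w)) T ∎
      where open ≡-Reasoning

module IdealSteps {n g : ℕ} (Γ : SimpleGraph g) (P : FinPoset n) (κ : Fin n → Fin g)
                  (ec : EC Γ P κ) (ice2 : ICE2 Γ P κ) where

  open FinPoset P using () renaming (_<_ to _<ᴾ_)

  ∈-Xideal⁻ : ∀ {a I J} → J ∈ₗ Xideal Γ P κ a I →
              ∃ λ x → MinimalOutside Γ P κ a I x × J ≡ I ∪ ⁅ x ⁆
  ∈-Xideal⁻ {a} {I} J∈ with ∈-map⁻ (λ x → I ∪ ⁅ x ⁆) J∈
  ... | x , x∈ , J≡ = x , proj₂ (∈-filter⁻ (minimalOutside? Γ P κ a I) {xs = allFin n} x∈) , J≡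

  Xideal≡[] : ∀ {a J} → (∀ z → ¬ MinimalOutside Γ P κ a J z) → Xideal Γ P κ a J ≡ []
  Xideal≡[] {a} {J} none =
    cong (map (λ x → J ∪ ⁅ x ⁆)) (filter-none (minimalOutside? Γ P κ a J) (All.universal none (allFin n)))

  ∪-minimal-isIdeal : ∀ {a I x} → IsIdeal Γ P κ I → MinimalOutside Γ P κ a I x →
                      IsIdeal Γ P κ (I ∪ ⁅ x ⁆)
  ∪-minimal-isIdeal {I = I} {x} idI (_ , _ , below-x) {u} {v} u∈ v≤u with x∈p∪q⁻ I ⁅ x ⁆ u∈
  ... | inj₁ u∈I = x∈p∪q⁺ (inj₁ (idI u∈I v≤u))
  ... | inj₂ u∈x with x∈⁅y⁆⇒x≡y x u∈x
  ...   | refl with v ≟ᶠ u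
  ...     | yes refl = x∈p∪q⁺ (inj₂ (x∈⁅x⁆ v))
  ...     | no v≢u   = x∈p∪q⁺ (inj₁ (below-x v (v≤u , v≢u)))

  Xideal-isIdeal : ∀ {a I J} → IsIdeal Γ P κ I → J ∈ₗ Xideal Γ P κ a I → IsIdeal Γ P κ J
  Xideal-isIdeal idI J∈ with ∈-Xideal⁻ J∈
  ... | x , x-min , refl = ∪-minimal-isIdeal idI x-min

  -- EC makes z comparable with y; if y < z, the interval (y, z) lies in J, so by the hypotheses
  -- it holds no element of colour a and at most one element at all, contradicting ICE2.
  ¬MinimalOutside-extension : ∀ {a I J y z} → MinimalOutside Γ P κ a I y → I ⊆ J → y ∈ J →
    (∀ u v → u ∈ J → v ∈ J → y <ᴾ u → y <ᴾ v → u ≡ v) →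
    (∀ u → u ∈ J → y <ᴾ u → κ u ≢ a) →
    ¬ MinimalOutside Γ P κ a J z
  ¬MinimalOutside-extension {y = y} {z} (_ , κy≡a , below-y) I⊆J y∈J unique colour (z∉J , κz≡a , below-z)
    with ec z y (trans κz≡a (sym κy≡a))
  ... | inj₁ z≤y with z ≟ᶠ y
  ...   | yes refl = z∉J y∈J
  ...   | no z≢y   = z∉J (I⊆J (below-y z (z≤y , z≢y)))
  ¬MinimalOutside-extension {y = y} {z} (_ , κy≡a , below-y) I⊆J y∈J unique colour (z∉J , κz≡a , below-z)
      | inj₂ y≤z
    with ice2 y z (y≤z , λ { refl → z∉J y∈J }) (trans κy≡a (sym κz≡a))
              (λ u y<u u<z κu≡κy → colour u (below-z u u<z) y<u (trans κu≡κy κy≡a))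
  ... | z₁ , z₂ , z₁≢z₂ , (y<z₁ , z₁<z , _) , (y<z₂ , z₂<z , _) , _ =
    z₁≢z₂ (unique z₁ z₂ (below-z z₁ z₁<z) (below-z z₂ z₂<z) y<z₁ y<z₂)

  not-above : ∀ {I y u} → IsIdeal Γ P κ I → y ∉ I → u ∈ I ∪ ⁅ y ⁆ → ¬ y <ᴾ u
  not-above {I} {y} idI y∉I u∈ (y≤u , y≢u) with x∈p∪q⁻ I ⁅ y ⁆ u∈
  ... | inj₁ u∈I = y∉I (idI u∈I y≤u)
  ... | inj₂ u∈y = y≢u (sym (x∈⁅y⁆⇒x≡y y u∈y))

  Xideal²≡[] : ∀ {a I J} → IsIdeal Γ P κ I → J ∈ₗ Xideal Γ P κ a I → Xideal Γ P κ a J ≡ []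
  Xideal²≡[] idI J∈ with ∈-Xideal⁻ J∈
  ... | y , y-min , refl =
    Xideal≡[] (λ z → ¬MinimalOutside-extension y-min (p⊆p∪q ⁅ y ⁆) (x∈p∪q⁺ (inj₂ (x∈⁅x⁆ y)))
                       (λ u _ u∈ _ y<u _ → ⊥-elim (not-above idI (proj₁ y-min) u∈ y<u))
                       (λ u u∈ y<u _ → not-above idI (proj₁ y-min) u∈ y<u))

  Xideal-c-b-c≡[] : ∀ {b c I J K} → b ≢ c → IsIdeal Γ P κ I → J ∈ₗ Xideal Γ P κ c I →
                    K ∈ₗ Xideal Γ P κ b J → Xideal Γ P κ c K ≡ []
  Xideal-c-b-c≡[] {b} {c} {I} b≢c idI J∈ K∈ with ∈-Xideal⁻ J∈
  ... | y , y-min , refl with ∈-Xideal⁻ K∈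
  ...   | x , (_ , κx≡b , _) , refl =
    Xideal≡[] (λ z → ¬MinimalOutside-extension y-min (λ u∈ → p⊆p∪q ⁅ x ⁆ (p⊆p∪q ⁅ y ⁆ u∈))
                       (p⊆p∪q ⁅ x ⁆ (x∈p∪q⁺ (inj₂ (x∈⁅x⁆ y))))
                       (λ u v u∈ v∈ y<u y<v → trans (above-y u∈ y<u) (sym (above-y v∈ y<v)))
                       (λ u u∈ y<u κu≡c →
                          b≢c (trans (sym κx≡b) (subst (λ t → κ t ≡ c) (above-y u∈ y<u) κu≡c))))
    where
    above-y : ∀ {u} → u ∈ (I ∪ ⁅ y ⁆) ∪ ⁅ x ⁆ → y <ᴾ u → u ≡ x
    above-y u∈ y<u with x∈p∪q⁻ (I ∪ ⁅ y ⁆) ⁅ x ⁆ u∈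
    ... | inj₁ u∈I∪y = ⊥-elim (not-above idI (proj₁ y-min) u∈I∪y y<u)
    ... | inj₂ u∈x   = x∈⁅y⁆⇒x≡y x u∈x

module AlternatingSum {n g : ℕ} (Γ : SimpleGraph g) (P : FinPoset n) (κ : Fin n → Fin g)
                      (ec : EC Γ P κ) (ice2 : ICE2 Γ P κ) {b c : Fin g} (b≢c : b ≢ c) where

  open Transposes Γ P κ
  open IdealSteps Γ P κ ec ice2

  cbcᵀ : ∀ {m} → ℕ → ℕ → ℕ → W m → W m
  cbcᵀ i p j w = ⟨ c ^ i ⟩ᵀ (⟨ b ^ p ⟩ᵀ (⟨ c ^ j ⟩ᵀ w))

  expand-cong-isIdeal : ∀ {a I} k {φ ψ : ℕ → Subset n → ℚ} → IsIdeal Γ P κ I →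
    (∀ l J → IsIdeal Γ P κ J → φ l J ≡ ψ l J) → expand (Xid a) k φ I ≡ expand (Xid a) k ψ I
  expand-cong-isIdeal {a} {I} k idI eq =
    expand-cong (Xid a) k I (eq k I idI) (λ l _ J J∈ → eq l J (Xideal-isIdeal idI J∈))

  fiber-expansion : ∀ {m a I} {O : W m → W m} → IsLinear O → IsIdeal Γ P κ I → ∀ k (w : W (suc m)) T →
    O (fiber (⟨ a ^ k ⟩ᵀ w) I) T ≡ expand (Xid a) k (λ l J → O (⟨ a ^ l ⟩ᵀ (fiber w J)) T) I
  fiber-expansion {a = a} {I} L idI k w T =
    trans (IsLinear.resp-≗ L (⟨^⟩ᵀ-head a I (λ J → Xideal²≡[] idI) k w) T)
          (IsLinear.expand-homo L (Xid a) k I (λ l J → ⟨ a ^ l ⟩ᵀ (fiber w J)) T)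

  cbcᵀ-head : ∀ {m I} → IsIdeal Γ P κ I → ∀ i p j (w : W (suc m)) T →
    cbcᵀ i p j w (I ∷ T) ≡
    expand (Xid c) i (λ i′ → expand (Xid b) p (λ p′ →
      expand (Xid c) j (λ j′ J → cbcᵀ i′ p′ j′ (fiber w J) T))) I
  cbcᵀ-head idI i p j w T =
    trans (fiber-expansion id-linear idI i (⟨ b ^ p ⟩ᵀ (⟨ c ^ j ⟩ᵀ w)) T)
      (expand-cong-isIdeal i idI (λ i′ J idJ →
        trans (fiber-expansion (⟨^⟩ᵀ-linear c i′) idJ p (⟨ c ^ j ⟩ᵀ w) T)
              (expand-cong-isIdeal p idJ (λ p′ J′ idJ′ →
                fiber-expansion (∘-linear (⟨^⟩ᵀ-linear c i′) (⟨^⟩ᵀ-linear b p′)) idJ′ j w T))))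

  altDiag-cbcᵀ≡0 : ∀ {m} (T : Tuple Γ P κ m) → AllIdeals Γ P κ T → ∀ {p q} → p < q → ∀ w →
                   altDiag (λ i j → cbcᵀ i p j w T) q ≡ 0ℚ
  altDiag-cbcᵀ≡0 [] _ {p} {suc q} _ w =
    cong₂ _-_ (⟨^⟩ᵀ-[] c 0 (⟨ b ^ p ⟩ᵀ (⟨ c ^ suc q ⟩ᵀ w))
                (⟨^⟩ᵀ-[] b p (⟨ c ^ suc q ⟩ᵀ w) (⟨^suc⟩ᵀ-[] c q w)))
              (altDiag-zero q (λ i j → ⟨^suc⟩ᵀ-[] c i (⟨ b ^ p ⟩ᵀ (⟨ c ^ j ⟩ᵀ w))))
  altDiag-cbcᵀ≡0 (I ∷ T) ideals {p} {suc q} (s≤s p≤q) w = begin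
      altDiag (λ i j → cbcᵀ i p j w (I ∷ T)) (suc q)
    ≡⟨ altDiag-cong (suc q) (λ i j → cbcᵀ-head idI i p j w T) ⟩
      altDiag (λ i j → expand (Xid c) i (λ i′ → inner i′ j) I) (suc q)
    ≡⟨ altDiag-expandˡ (Xid c) q I inner ⟩
      altDiag (λ i j → inner i j I) (suc q) - ∑ (Xid c I) (λ J → altDiag (λ i j → inner i j J) q)
    ≡⟨ cong₂ _-_ outer-c-fixes-head (∑-cong (Xid c I) outer-c-moves-head) ⟩
      ∑ (Xid c I) (α p q) - ∑ (Xid c I) (α p q)
    ≡⟨ +-inverseʳ (∑ (Xid c I) (α p q)) ⟩
      0ℚ ∎
    where
    open ≡-Reasoning
    idI : IsIdeal Γ P κ I
    idI = ideals Fin.zero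

    IH : ∀ {p′ q′} → p′ < q′ → ∀ w → altDiag (λ i j → cbcᵀ i p′ j w T) q′ ≡ 0ℚ
    IH = altDiag-cbcᵀ≡0 T (ideals ∘ Fin.suc)

    Θ : ℕ → ℕ → ℕ → Subset n → ℚ
    Θ i p′ j J = cbcᵀ i p′ j (fiber w J) T

    α : ℕ → ℕ → Subset n → ℚ
    α p′ q′ J = altDiag (λ i j → Θ i p′ j J) q′

    inner : ℕ → ℕ → Subset n → ℚ
    inner i j = expand (Xid b) p (λ p′ → expand (Xid c) j (Θ i p′))

    pred<q : ∀ {p′} → suc p′ ≡ p → p′ < q
    pred<q refl = p≤q

    b-tail-vanishes : ∀ (F : ℕ → Subset n → ℚ) K → (∀ p′ → p′ < q → ∀ J → F p′ J ≡ 0ℚ) →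
                      expand (Xid b) p F K ≡ F p K
    b-tail-vanishes F K F≡0 = expand-head (Xid b) p K (λ p′ sp′≡p J _ → F≡0 p′ (pred<q sp′≡p) J)

    inner-c-shift : ∀ {p′} → p′ < suc q → ∀ J →
                altDiag (λ i j → expand (Xid c) j (Θ i p′) J) (suc q) ≡ ∑ (Xid c J) (α p′ q)
    inner-c-shift {p′} p′<sq J =
      trans (altDiag-expandʳ (Xid c) q J (λ i → Θ i p′))
            (trans (cong (_+ ∑ (Xid c J) (α p′ q)) (IH p′<sq (fiber w J))) (+-identityˡ _))

    outer-c-fixes-head : altDiag (λ i j → inner i j I) (suc q) ≡ ∑ (Xid c I) (α p q)
    outer-c-fixes-head = begin
        altDiag (λ i j → inner i j I) (suc q)
      ≡⟨ altDiag-expand (Xid b) (suc q) p I (λ p′ J i j → expand (Xid c) j (Θ i p′) J) ⟩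
        expand (Xid b) p (λ p′ J → altDiag (λ i j → expand (Xid c) j (Θ i p′) J) (suc q)) I
      ≡⟨ expand-cong (Xid b) p I (inner-c-shift (s≤s p≤q) I)
                     (λ p′ sp′≡p J _ → inner-c-shift (m<n⇒m<1+n (pred<q sp′≡p)) J) ⟩
        expand (Xid b) p (λ p′ J → ∑ (Xid c J) (α p′ q)) I
      ≡⟨ b-tail-vanishes (λ p′ J → ∑ (Xid c J) (α p′ q)) I
                         (λ p′ p′<q J → ∑-zero (Xid c J) (λ J′ _ → IH p′<q (fiber w J′))) ⟩
        ∑ (Xid c I) (α p q) ∎

    outer-c-moves-head : ∀ J → J ∈ₗ Xid c I → altDiag (λ i j → inner i j J) q ≡ α p q J
    outer-c-moves-head J J∈ = begin
        altDiag (λ i j → inner i j J) q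
      ≡⟨ altDiag-cong q c-exhausted ⟩
        altDiag (λ i j → expand (Xid b) p (λ p′ J′ → Θ i p′ j J′) J) q
      ≡⟨ altDiag-expand (Xid b) q p J (λ p′ J′ i j → Θ i p′ j J′) ⟩
        expand (Xid b) p (λ p′ → α p′ q) J
      ≡⟨ b-tail-vanishes (λ p′ → α p′ q) J (λ p′ p′<q J′ → IH p′<q (fiber w J′)) ⟩
        α p q J ∎
      where
      c-exhausted : ∀ i j → inner i j J ≡ expand (Xid b) p (λ p′ J′ → Θ i p′ j J′) J
      c-exhausted i j = expand-cong (Xid b) p J (expand-[] (Xid c) j J {Θ i p} (Xideal²≡[] idI J∈))
                          (λ p′ _ J′ J′∈ → expand-[] (Xid c) j J′ {Θ i p′} (Xideal-c-b-c≡[] b≢c idI J∈ J′∈))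

lemma5p3 : ∀ {n g : ℕ} (Γ : SimpleGraph g) (P : FinPoset n) (κ : Fin n → Fin g) →
    Surjective Γ P κ → 1 ≤ n → Connected P →
    EC Γ P κ → NA Γ P κ → AC Γ P κ → ICE2 Γ P κ →
    ∀ (m p q : ℕ) → 1 ≤ m → p < q →
    ∀ (b c : Fin g) → b ≢ c →
      (∀ (T J : Tuple Γ P κ m) → AllIdeals Γ P κ T →
         coeffTuple Γ P κ J (alternatingSum Γ P κ b c p q (basis Γ P κ T)) ≡ 0ℚ)
      ×
      (∀ (T J : Tuple Γ P κ m) → AllIdeals Γ P κ T →
         coeffMultiset Γ P κ J (alternatingSum Γ P κ b c p q (basis Γ P κ T)) ≡ 0ℚ)
lemma5p3 Γ P κ _ _ _ ec _ _ ice2 m p q _ p<q b c b≢c =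
  (λ T J ideals → coefficient-vanishes T ideals (λ U → _≟T_ Γ P κ U J)) ,
  (λ T J ideals → coefficient-vanishes T ideals (λ U → sameMultiset? Γ P κ U J))
  where
  open Transposes Γ P κ
  open AlternatingSum Γ P κ ec ice2 b≢c

  coefficient-vanishes : ∀ T → AllIdeals Γ P κ T → ∀ {Q : Tuple Γ P κ m → Set} (Q? : Decidable Q) →
    ∑ (filter (Q? ∘ proj₂) (alternatingSum Γ P κ b c p q (basis Γ P κ T))) proj₁ ≡ 0ℚ
  coefficient-vanishes T ideals Q? = begin
    ∑ (filter (Q? ∘ proj₂) v) proj₁            ≡⟨ ∑-filter (Q? ∘ proj₂) v proj₁ ⟩
    ⟦ v ⟧ (𝟙 ∘ Q?)                             ≡⟨ ⟦alternatingSum⟧ b c p q T (𝟙 ∘ Q?) ⟩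
    altDiag (λ i j → cbcᵀ i p j (𝟙 ∘ Q?) T) q  ≡⟨ altDiag-cbcᵀ≡0 T ideals p<q (𝟙 ∘ Q?) ⟩
    0ℚ                                         ∎
    where
    open ≡-Reasoning
    v : FormalSum Γ P κ m
    v = alternatingSum Γ P κ b c p q (basis Γ P κ T)
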